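{- Let $q$ be a prime and let $u$ be a positive integer. Then $q^{2q+4}u$ is product-admissible.
   Context: For a multiset $\{x_1,\dots,x_n\}$ of positive integers define $T\{x_1,\dots,x_n\}=(x_1+\cdots+x_n,\,x_1x_2\cdots x_n,\,n)$. An ordered triple $(s,p,n)$ of positive integers is called admissible if there exist at least two different multisets $X$, $Y$ of $n$ positive integers with $T(X)=T(Y)=(s,p,n)$. A positive integer $p$ is product-admissible if there exist positive integers $s$ and $n$ such that $(s,p,n)$ is admissible. -}

module Defs where

open import Data.Nat using (ℕ; _>_; _^_; _*_; _+_)
open import Data.List using (List; length)
open import Data.Nat.ListAction using (sum; product)
open import Data.List.Relation.Unary.All using (All)
open import Data.List.Relation.Binary.Permutation.Propositional using (_↭_)
open import Data.Product using (Σ; ∃; _×_)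
open import Relation.Binary.PropositionalEquality using (_≡_)
open import Relation.Nullary using (¬_)

-- A finite multiset of positive integers is represented by a list of
-- positive naturals; two lists represent the same multiset iff they are
-- permutations of each other (_↭_).

Realises : ℕ → ℕ → ℕ → List ℕ → Set
Realises s p n X = All (λ x → x > 0) X × length X ≡ n × sum X ≡ s × product X ≡ p

Admissible : ℕ → ℕ → ℕ → Set
Admissible s p n =
  Σ (List ℕ) λ X → Σ (List ℕ) λ Y →
    Realises s p n X × Realises s p n Y × ¬ (X ↭ Y)

ProductAdmissible : ℕ → Set
ProductAdmissible p = Σ ℕ λ s → Σ ℕ λ n → s > 0 × n > 0 × Admissible s p n

{-# OPTIONS --safe #-}
-- For q > 1, the multiset of q³ together with 2q + 1 copies of q, and the
-- multiset of q + 2 copies of q² together with q copies of 1, both have 2q + 2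
-- elements, sum q³ + 2q² + q and product q^(2q+4), yet only the second
-- contains 1. Adjoining the same element u to both keeps them distinct and
-- turns the product into q^(2q+4) u. Primality of q is only used for q > 1.
module Submission where

open import Defs
open import Data.Nat using (ℕ; NonZero; >-nonZero⁻¹; zero; suc; _+_; _*_; _^_; _<_; _>_; s≤s; z≤n)
open import Data.Nat.Primality using (Prime; prime⇒nonTrivial)
open import Data.Nat.Base using (nonTrivial⇒n>1)
open import Data.Nat.Properties
  using (*-comm; ^-distribˡ-+-*; ^-*-assoc; ^-zeroˡ; *-identityʳ; m^n>0; ^-monoˡ-<; m≤m+n; ≤-trans; <-irrefl)
open import Data.Nat.ListAction using (sum; product)
open import Data.Nat.ListAction.Properties using (sum-++; product-++)
open import Data.Nat.Tactic.RingSolver using (solve-∀)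
open import Data.List using (List; _∷_; _++_; replicate)
open import Data.List.Properties using (length-++; length-replicate)
open import Data.List.Relation.Unary.All using (All; _∷_; head)
open import Data.List.Relation.Unary.All.Properties using (++⁺; ++⁻ʳ; replicate⁺)
open import Data.List.Relation.Binary.Permutation.Propositional using (_↭_)
open import Data.List.Relation.Binary.Permutation.Propositional.Properties using (All-resp-↭; drop-∷)
open import Data.Product using (_,_)
open import Relation.Binary.PropositionalEquality using (_≡_; refl; cong; cong₂; subst; trans; module ≡-Reasoning)
open import Relation.Nullary using (¬_)

sum-replicate : ∀ n x → sum (replicate n x) ≡ n * x
sum-replicate zero    x = refl
sum-replicate (suc n) x = cong (x +_) (sum-replicate n x)

product-replicate : ∀ n x → product (replicate n x) ≡ x ^ n
product-replicate zero    x = refl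
product-replicate (suc n) x = cong (x *_) (product-replicate n x)

Realises-∷ : ∀ {s p n X} u → u > 0 → Realises s p n X → Realises (u + s) (u * p) (suc n) (u ∷ X)
Realises-∷ u u>0 (X>0 , refl , refl , refl) = u>0 ∷ X>0 , refl , refl , refl

Admissible-∷ : ∀ {s p n} u → u > 0 → Admissible s p n → Admissible (u + s) (u * p) (suc n)
Admissible-∷ u u>0 (X , Y , rX , rY , X≁Y) =
  u ∷ X , u ∷ Y , Realises-∷ u u>0 rX , Realises-∷ u u>0 rY , λ uX↭uY → X≁Y (drop-∷ uX↭uY)

private
  size-cube-and-linears : ∀ q → suc (2 * q + 1) ≡ 2 * q + 2
  size-cube-and-linears = solve-∀

  size-squares-and-ones : ∀ q → q + 2 + q ≡ 2 * q + 2
  size-squares-and-ones = solve-∀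

  -- q ^ 3 and q ^ 2 unfolded, since the solver does not read _^_.
  sums-agree : ∀ q → (q + 2) * (q * (q * 1)) + q * 1 ≡ q * (q * (q * 1)) + (2 * q + 1) * q
  sums-agree = solve-∀

  exponent-cube-and-linears : ∀ q → 3 + (2 * q + 1) ≡ 2 * q + 4
  exponent-cube-and-linears = solve-∀

  exponent-squares-and-ones : ∀ q → 2 * (q + 2) ≡ 2 * q + 4
  exponent-squares-and-ones = solve-∀

cube-and-linears : ℕ → List ℕ
cube-and-linears q = q ^ 3 ∷ replicate (2 * q + 1) q

squares-and-ones : ℕ → List ℕ
squares-and-ones q = replicate (q + 2) (q ^ 2) ++ replicate q 1

module _ (q : ℕ) .{{_ : NonZero q}} where

  realises-cube-and-linears :
    Realises (q ^ 3 + (2 * q + 1) * q) (q ^ (2 * q + 4)) (2 * q + 2) (cube-and-linears q)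
  realises-cube-and-linears =
      m^n>0 q 3 ∷ replicate⁺ (2 * q + 1) (>-nonZero⁻¹ q)
    , trans (cong suc (length-replicate (2 * q + 1))) (size-cube-and-linears q)
    , cong (q ^ 3 +_) (sum-replicate (2 * q + 1) q)
    , (begin
        q ^ 3 * product (replicate (2 * q + 1) q) ≡⟨ cong (q ^ 3 *_) (product-replicate (2 * q + 1) q) ⟩
        q ^ 3 * q ^ (2 * q + 1)                   ≡⟨ ^-distribˡ-+-* q 3 (2 * q + 1) ⟨
        q ^ (3 + (2 * q + 1))                     ≡⟨ cong (q ^_) (exponent-cube-and-linears q) ⟩
        q ^ (2 * q + 4)                           ∎)
    where open ≡-Reasoning

  realises-squares-and-ones :
    Realises (q ^ 3 + (2 * q + 1) * q) (q ^ (2 * q + 4)) (2 * q + 2) (squares-and-ones q)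
  realises-squares-and-ones =
      ++⁺ (replicate⁺ (q + 2) (m^n>0 q 2)) (replicate⁺ q (s≤s z≤n))
    , trans (trans (length-++ (replicate (q + 2) (q ^ 2)))
                   (cong₂ _+_ (length-replicate (q + 2)) (length-replicate q)))
            (size-squares-and-ones q)
    , (begin
        sum (replicate (q + 2) (q ^ 2) ++ replicate q 1)
          ≡⟨ sum-++ (replicate (q + 2) (q ^ 2)) (replicate q 1) ⟩
        sum (replicate (q + 2) (q ^ 2)) + sum (replicate q 1)
          ≡⟨ cong₂ _+_ (sum-replicate (q + 2) (q ^ 2)) (sum-replicate q 1) ⟩
        (q + 2) * q ^ 2 + q * 1
          ≡⟨ sums-agree q ⟩
        q ^ 3 + (2 * q + 1) * q ∎)
    , (begin
        product (replicate (q + 2) (q ^ 2) ++ replicate q 1)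
          ≡⟨ product-++ (replicate (q + 2) (q ^ 2)) (replicate q 1) ⟩
        product (replicate (q + 2) (q ^ 2)) * product (replicate q 1)
          ≡⟨ cong₂ _*_ (product-replicate (q + 2) (q ^ 2)) (product-replicate q 1) ⟩
        (q ^ 2) ^ (q + 2) * 1 ^ q
          ≡⟨ cong₂ _*_ (^-*-assoc q 2 (q + 2)) (^-zeroˡ q) ⟩
        q ^ (2 * (q + 2)) * 1
          ≡⟨ *-identityʳ _ ⟩
        q ^ (2 * (q + 2))
          ≡⟨ cong (q ^_) (exponent-squares-and-ones q) ⟩
        q ^ (2 * q + 4) ∎)
    where open ≡-Reasoning

cube-and-linears≁squares-and-ones : ∀ q → 1 < q → ¬ (cube-and-linears q ↭ squares-and-ones q)
cube-and-linears≁squares-and-ones q@(suc _) 1<q X↭Y = <-irrefl refl 1<1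
  where
  all>1 : All (1 <_) (cube-and-linears q)
  all>1 = ^-monoˡ-< 3 1<q ∷ replicate⁺ (2 * q + 1) 1<q
  1<1 : 1 < 1
  1<1 = head (++⁻ʳ (replicate (q + 2) (q ^ 2)) (All-resp-↭ X↭Y all>1))

admissible-q^[2q+4] : ∀ q → 1 < q → Admissible (q ^ 3 + (2 * q + 1) * q) (q ^ (2 * q + 4)) (2 * q + 2)
admissible-q^[2q+4] q@(suc _) 1<q =
    cube-and-linears q , squares-and-ones q
  , realises-cube-and-linears q , realises-squares-and-ones q
  , cube-and-linears≁squares-and-ones q 1<q

corollary3p3 : (q u : ℕ) → Prime q → u > 0 → ProductAdmissible (q ^ (2 * q + 4) * u)
corollary3p3 q u q-prime u>0 =
  u + s , suc (2 * q + 2) , ≤-trans u>0 (m≤m+n u s) , s≤s z≤n ,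
  subst (λ p → Admissible (u + s) p (suc (2 * q + 2))) (*-comm u (q ^ (2 * q + 4)))
        (Admissible-∷ u u>0 (admissible-q^[2q+4] q 1<q))
  where
  s : ℕ
  s = q ^ 3 + (2 * q + 1) * q
  1<q : 1 < q
  1<q = nonTrivial⇒n>1 q {{prime⇒nonTrivial q-prime}}
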